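{- Let $G=(V,E)$ be a graph and $X$ a cluster vertex deletion of $G$. For $x\in X$, let $L_x$ be the set of clusters of $G[V\setminus X]$ containing a neighbor of $x$, and for a cluster $C\in L_x$ let $P^+_{x,C}=C\cap N(x)$ and $P^-_{x,C}=C\setminus N(x)$. Let $X_0=\{x\in X: |L_x|>|X|+1\}$, and let $V'$ be any set consisting of every $x\in X\setminus X_0$ together with, for every such $x$ and every $C\in L_x$, a subset of $P^+_{x,C}$ of size $\min(|P^+_{x,C}|,|X|+1)$ and a subset of $P^-_{x,C}$ of size $\min(|P^-_{x,C}|,|X|+1)$. If $S\subseteq V'$ is a cluster vertex deletion of $G[V']$ with $|S|\le|X\setminus X_0|$, then $S\cup X_0$ is a cluster vertex deletion of $G$.
   Context: A cluster graph is a graph each of whose connected components (clusters) is a clique. A set $X\subseteq V$ is a cluster vertex deletion of $G$ if $G[V\setminus X]$ is a cluster graph. -}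

module Defs where

open import Data.Nat using (ℕ; suc; _<_; _⊓_)
open import Data.Bool using (Bool; true; false)
open import Data.Fin using (Fin)
open import Data.Fin.Subset using (Subset; _∈_; _∉_; _⊆_; _∩_; _─_; ∁; ∣_∣)
open import Data.Vec using (tabulate)
open import Data.List using (List; length)
open import Data.List.Relation.Unary.All using (All)
open import Data.List.Relation.Unary.Unique.Propositional using (Unique)
open import Data.Product using (Σ; ∃; ∃-syntax; _×_)
open import Data.Sum using (_⊎_)
open import Function.Bundles using (_⇔_)
open import Relation.Binary.PropositionalEquality using (_≡_)
open import Relation.Nullary using (¬_)

record Graph (n : ℕ) : Set where
  field
    Adj    : Fin n → Fin n → Bool
    sym    : ∀ u v → Adj u v ≡ Adj v u
    irrefl : ∀ v → Adj v v ≡ false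

open Graph public

module _ {n : ℕ} (G : Graph n) where

  Adjacent : Fin n → Fin n → Set
  Adjacent u v = Adj G u v ≡ true

  N : Fin n → Subset n
  N x = tabulate (Adj G x)

  data Reach (Y : Subset n) : Fin n → Fin n → Set where
    here : ∀ {v} → v ∈ Y → Reach Y v v
    step : ∀ {u v w} → Reach Y u v → Adjacent v w → w ∈ Y → Reach Y u w

  IsClusterGraphOn : Subset n → Set
  IsClusterGraphOn Y = ∀ u v → Reach Y u v → u ≡ v ⊎ Adjacent u v

  IsCVD : Subset n → Set
  IsCVD X = IsClusterGraphOn (∁ X)

  IsClusterOf : Subset n → Subset n → Set
  IsClusterOf Y C = ∃[ v ] (v ∈ Y × (∀ u → (u ∈ C) ⇔ Reach Y v u))

  InL : Subset n → Fin n → Subset n → Set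
  InL X x C = IsClusterOf (∁ X) C × ∃[ v ] (v ∈ C × Adjacent x v)

  ManyClusters : Subset n → Fin n → Set
  ManyClusters X x = ∃[ Cs ] (Unique Cs × All (InL X x) Cs × suc ∣ X ∣ < length Cs)

  P⁺ : Fin n → Subset n → Subset n
  P⁺ x C = C ∩ N x

  P⁻ : Fin n → Subset n → Subset n
  P⁻ x C = C ─ N x

  IsX0 : Subset n → Subset n → Set
  IsX0 X X0 = ∀ x → (x ∈ X0) ⇔ (x ∈ X × ManyClusters X x)

  IsReducedSet : Subset n → Subset n → Subset n →
                 (Fin n → Subset n → Subset n) → (Fin n → Subset n → Subset n) → Set
  IsReducedSet X X0 V' Q⁺ Q⁻ =
    (∀ x C → x ∈ X ─ X0 → InL X x C →
       (Q⁺ x C ⊆ P⁺ x C × ∣ Q⁺ x C ∣ ≡ ∣ P⁺ x C ∣ ⊓ suc ∣ X ∣) ×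
       (Q⁻ x C ⊆ P⁻ x C × ∣ Q⁻ x C ∣ ≡ ∣ P⁻ x C ∣ ⊓ suc ∣ X ∣)) ×
    (∀ v → (v ∈ V') ⇔
       (v ∈ X ─ X0 ⊎
        ∃[ x ] ∃[ C ] (x ∈ X ─ X0 × InL X x C × (v ∈ Q⁺ x C ⊎ v ∈ Q⁻ x C))))

-- A graph is a cluster graph iff it has no induced path u – v – w.  Suppose such a path
-- survives in G − (S ∪ X0).  Its vertices in X lie in X ∖ X0 ⊆ V' ∖ S.  Each vertex outside X
-- lies in a cluster C of G − X, and for a surviving x ∈ X the sets Q⁺ x C, Q⁻ x C of V' have
-- size min(|P±|, |X| + 1) > |S| unless they exhaust P±, so they contain an undeleted vertex with
-- the same adjacency to x as any given undeleted vertex of C.  Hence a surviving x ∈ X sees all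
-- or none of the undeleted part of each cluster, and the path can be moved into V' ∖ S, where
-- S is a cluster vertex deletion.
module Submission where

open import Defs hiding (sym)
open import Data.Nat using (ℕ; suc; _≤_; _<_; _⊓_; s≤s)
open import Data.Nat.Properties using (≤-trans; <-irrefl; ⊓-glb)
open import Data.Bool using (true)
import Data.Bool.Properties as Bool
open import Data.Fin using (Fin)
open import Data.Fin.Properties using (any?) renaming (_≟_ to _≟ᶠ_)
open import Data.Fin.Subset
  using (Subset; inside; outside; _∈_; _∉_; _⊆_; _∩_; _∪_; _─_; ∁; ⁅_⁆; ∣_∣)
open import Data.Fin.Subset.Properties
  using ( _∈?_; p⊆q⇒∣p∣≤∣q∣; p⊂q⇒∣p∣<∣q∣; ∣p─q∣≤∣p∣; p─q⊆p; x∈p∧x∉q⇒x∈p─q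
        ; x∈p∩q⁺; x∈p∩q⁻; x∈p∪q⁺; x∈p∪q⁻; x∈⁅x⁆; x∈⁅y⁆⇒x≡y
        ; x∈∁p⇒x∉p; x∉p⇒x∈∁p )
open import Data.Vec.Properties using (lookup∘tabulate; []=⇒lookup; lookup⇒[]=)
open import Data.Vec using (_∷_; here; there)
open import Data.Product using (∃-syntax; _×_; _,_; proj₁; proj₂)
open import Data.Sum using (_⊎_; inj₁; inj₂)
open import Function.Bundles using (Equivalence; mk⇔)
open import Relation.Binary.PropositionalEquality using (_≡_; _≢_; refl; sym; trans; subst)
open import Relation.Nullary using (¬_; Dec; yes; no; contradiction)
open import Relation.Nullary.Decidable using (¬?; _×-dec_)

x∈p─q⇒x∉q : ∀ {n} {x : Fin n} (p q : Subset n) → x ∈ p ─ q → x ∉ q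
x∈p─q⇒x∉q (inside ∷ p) (outside ∷ q) here      ()
x∈p─q⇒x∉q (_ ∷ p)      (_ ∷ q)       (there m) (there m′) = x∈p─q⇒x∉q p q m m′

truncated-subset-escapes : ∀ {n} {P Q S : Subset n} {k a} → Q ⊆ P → ∣ Q ∣ ≡ ∣ P ∣ ⊓ suc k →
                           ∣ S ∣ ≤ k → a ∈ P → a ∉ S → ∃[ q ] (q ∈ Q × q ∉ S)
truncated-subset-escapes {Q = Q} {S} {k} {a} Q⊆P ∣Q∣≡ ∣S∣≤k a∈P a∉S
  with any? (λ q → (q ∈? Q) ×-dec ¬? (q ∈? S))
... | yes escapee = escapee
... | no ¬escapee =
  contradiction (subst (suc ∣ Q ∣ ≤_) (sym ∣Q∣≡) (⊓-glb ∣Q∣<∣P∣ ∣Q∣<1+k)) (<-irrefl refl)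
  where
  Q⊆S : Q ⊆ S
  Q⊆S {q} q∈Q with q ∈? S
  ... | yes q∈S = q∈S
  ... | no  q∉S = contradiction (q , q∈Q , q∉S) ¬escapee

  ∣Q∣<∣P∣ : ∣ Q ∣ < _
  ∣Q∣<∣P∣ = p⊂q⇒∣p∣<∣q∣ (Q⊆P , a , a∈P , λ a∈Q → a∉S (Q⊆S a∈Q))

  ∣Q∣<1+k : ∣ Q ∣ < suc k
  ∣Q∣<1+k = s≤s (≤-trans (p⊆q⇒∣p∣≤∣q∣ Q⊆S) ∣S∣≤k)

module _ {n : ℕ} (G : Graph n) where

  adjacent? : ∀ u v → Dec (Adjacent G u v)
  adjacent? u v = Adj G u v Bool.≟ true

  Adjacent-sym : ∀ {u v} → Adjacent G u v → Adjacent G v u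
  Adjacent-sym {u} {v} = trans (Graph.sym G v u)

  ∈N⁺ : ∀ {x u} → Adjacent G x u → u ∈ N G x
  ∈N⁺ {x} {u} xu = lookup⇒[]= u _ (trans (lookup∘tabulate (Adj G x) u) xu)

  ∈N⁻ : ∀ {x u} → u ∈ N G x → Adjacent G x u
  ∈N⁻ {x} {u} u∈N = trans (sym (lookup∘tabulate (Adj G x) u)) ([]=⇒lookup u∈N)

  AdjacentOrEqual : Fin n → Fin n → Set
  AdjacentOrEqual u v = u ≡ v ⊎ Adjacent G u v

  AdjacentOrEqual-sym : ∀ {u v} → AdjacentOrEqual u v → AdjacentOrEqual v u
  AdjacentOrEqual-sym (inj₁ refl) = inj₁ refl
  AdjacentOrEqual-sym (inj₂ uv)   = inj₂ (Adjacent-sym uv)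

  Reach-source : ∀ {Y u v} → Reach G Y u v → u ∈ Y
  Reach-source (here u∈Y)   = u∈Y
  Reach-source (step r _ _) = Reach-source r

  Reach-target : ∀ {Y u v} → Reach G Y u v → v ∈ Y
  Reach-target (here v∈Y)     = v∈Y
  Reach-target (step _ _ v∈Y) = v∈Y

  Reach-extend : ∀ {Y u v w} → Reach G Y u v → AdjacentOrEqual v w → w ∈ Y → Reach G Y u w
  Reach-extend r (inj₁ refl) _   = r
  Reach-extend r (inj₂ vw)   w∈Y = step r vw w∈Y

  -- No induced P₃ in G[Y], stated positively: every path u – v – w with u ≢ w closes to a triangle.
  P₃-free : Subset n → Set
  P₃-free Y = ∀ {u v w} → u ∈ Y → v ∈ Y → w ∈ Y →
              Adjacent G u v → Adjacent G v w → u ≢ w → Adjacent G u w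

  clusterGraph⇒P₃-free : ∀ {Y} → IsClusterGraphOn G Y → P₃-free Y
  clusterGraph⇒P₃-free cluster u∈Y v∈Y w∈Y uv vw u≢w
    with cluster _ _ (step (step (here u∈Y) uv v∈Y) vw w∈Y)
  ... | inj₁ u≡w = contradiction u≡w u≢w
  ... | inj₂ uw  = uw

  P₃-free⇒clusterGraph : ∀ {Y} → P₃-free Y → IsClusterGraphOn G Y
  P₃-free⇒clusterGraph free u .u (here _) = inj₁ refl
  P₃-free⇒clusterGraph free u w (step {v = v} r vw w∈Y)
    with P₃-free⇒clusterGraph free u v r
  ... | inj₁ refl = inj₂ vw
  ... | inj₂ uv with u ≟ᶠ w
  ...   | yes u≡w = inj₁ u≡w
  ...   | no  u≢w = inj₂ (free (Reach-source r) (Reach-target r) w∈Y uv vw u≢w)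

-- Because G − X is a cluster graph, the cluster of a is its closed neighbourhood in G − X.
module Clusters {n : ℕ} (G : Graph n) (X : Subset n) (cvd : IsCVD G X) where

  cluster : Fin n → Subset n
  cluster a = ∁ X ∩ (⁅ a ⁆ ∪ N G a)

  ∈cluster⁺ : ∀ {a u} → u ∉ X → AdjacentOrEqual G a u → u ∈ cluster a
  ∈cluster⁺ u∉X (inj₁ refl) = x∈p∩q⁺ (x∉p⇒x∈∁p u∉X , x∈p∪q⁺ (inj₁ (x∈⁅x⁆ _)))
  ∈cluster⁺ u∉X (inj₂ au)   = x∈p∩q⁺ (x∉p⇒x∈∁p u∉X , x∈p∪q⁺ (inj₂ (∈N⁺ G au)))

  ∈cluster⁻ : ∀ {a u} → u ∈ cluster a → u ∈ ∁ X × AdjacentOrEqual G a u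
  ∈cluster⁻ {a} u∈C with x∈p∩q⁻ (∁ X) _ u∈C
  ... | u∈∁X , u∈a∪Na with x∈p∪q⁻ ⁅ a ⁆ (N G a) u∈a∪Na
  ...   | inj₁ u∈⁅a⁆ = u∈∁X , inj₁ (sym (x∈⁅y⁆⇒x≡y a u∈⁅a⁆))
  ...   | inj₂ u∈Na  = u∈∁X , inj₂ (∈N⁻ G u∈Na)

  ∈cluster⇒∉ : ∀ {a u} → u ∈ cluster a → u ∉ X
  ∈cluster⇒∉ u∈C = x∈∁p⇒x∉p (proj₁ (∈cluster⁻ u∈C))

  ∈cluster-self : ∀ {a} → a ∉ X → a ∈ cluster a
  ∈cluster-self a∉X = ∈cluster⁺ a∉X (inj₁ refl)

  reach-from : ∀ {a u} → a ∉ X → u ∈ cluster a → Reach G (∁ X) a u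
  reach-from a∉X u∈C = Reach-extend G (here (x∉p⇒x∈∁p a∉X)) (proj₂ (∈cluster⁻ u∈C)) (proj₁ (∈cluster⁻ u∈C))

  reach-to : ∀ {a u} → a ∉ X → u ∈ cluster a → Reach G (∁ X) u a
  reach-to a∉X u∈C =
    Reach-extend G (here (proj₁ (∈cluster⁻ u∈C))) (AdjacentOrEqual-sym G (proj₂ (∈cluster⁻ u∈C))) (x∉p⇒x∈∁p a∉X)

  cluster-isClusterOf : ∀ {a} → a ∉ X → IsClusterOf G (∁ X) (cluster a)
  cluster-isClusterOf {a} a∉X = a , x∉p⇒x∈∁p a∉X , λ u → mk⇔ (reach-from a∉X)
    (λ r → ∈cluster⁺ (x∈∁p⇒x∉p (Reach-target G r)) (cvd a u r))

  cluster-∈L : ∀ {a b x} → a ∉ X → b ∈ cluster a → Adjacent G x b → InL G X x (cluster a)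
  cluster-∈L a∉X b∈C xb = cluster-isClusterOf a∉X , _ , b∈C , xb

  cluster-clique : ∀ {a b c} → a ∉ X → b ∈ cluster a → c ∈ cluster a → AdjacentOrEqual G b c
  cluster-clique a∉X b∈C c∈C =
    cvd _ _ (Reach-extend G (reach-to a∉X b∈C) (proj₂ (∈cluster⁻ c∈C)) (proj₁ (∈cluster⁻ c∈C)))

  clusters-linked : ∀ {a b a′ b′} → a ∉ X → b ∉ X → a′ ∈ cluster a → b′ ∈ cluster b →
                    AdjacentOrEqual G a′ b′ → AdjacentOrEqual G a b
  clusters-linked a∉X b∉X a′∈C b′∈D a′b′ = cvd _ _
    (Reach-extend G (Reach-extend G (reach-from a∉X a′∈C) a′b′ (proj₁ (∈cluster⁻ b′∈D)))
      (AdjacentOrEqual-sym G (proj₂ (∈cluster⁻ b′∈D))) (x∉p⇒x∈∁p b∉X))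

module Reduction {n : ℕ} (G : Graph n) (X X0 V' S : Subset n)
    (Q⁺ Q⁻ : Fin n → Subset n → Subset n)
    (cvd : IsCVD G X)
    (reduced : IsReducedSet G X X0 V' Q⁺ Q⁻)
    (V'─S-cluster : IsClusterGraphOn G (V' ─ S))
    (∣S∣≤∣X─X0∣ : ∣ S ∣ ≤ ∣ X ─ X0 ∣) where

  open Clusters G X cvd

  Y : Subset n
  Y = ∁ (S ∪ X0)

  ∈Y⇒∉S : ∀ {u} → u ∈ Y → u ∉ S
  ∈Y⇒∉S u∈Y u∈S = x∈∁p⇒x∉p u∈Y (x∈p∪q⁺ (inj₁ u∈S))

  ∈Y∩X⇒∈X─X0 : ∀ {u} → u ∈ Y → u ∈ X → u ∈ X ─ X0
  ∈Y∩X⇒∈X─X0 u∈Y u∈X = x∈p∧x∉q⇒x∈p─q u∈X (λ u∈X0 → x∈∁p⇒x∉p u∈Y (x∈p∪q⁺ (inj₂ u∈X0)))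

  ∈Y∩X⇒∈V'─S : ∀ {u} → u ∈ Y → u ∈ X → u ∈ V' ─ S
  ∈Y∩X⇒∈V'─S {u} u∈Y u∈X =
    x∈p∧x∉q⇒x∈p─q (Equivalence.from (proj₂ reduced u) (inj₁ (∈Y∩X⇒∈X─X0 u∈Y u∈X))) (∈Y⇒∉S u∈Y)

  ∈Q⇒∈V' : ∀ {x C q} → x ∈ X ─ X0 → InL G X x C → q ∈ Q⁺ x C ⊎ q ∈ Q⁻ x C → q ∈ V'
  ∈Q⇒∈V' {x} {C} {q} x∈ C∈L q∈Q = Equivalence.from (proj₂ reduced q) (inj₂ (x , C , x∈ , C∈L , q∈Q))

  ∈X∧∉X⇒≢ : ∀ {u v} → u ∈ X → v ∉ X → u ≢ v
  ∈X∧∉X⇒≢ u∈X v∉X refl = v∉X u∈X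

  V'─S-P₃-free : P₃-free G (V' ─ S)
  V'─S-P₃-free = clusterGraph⇒P₃-free G V'─S-cluster

  ∣S∣≤∣X∣ : ∣ S ∣ ≤ ∣ X ∣
  ∣S∣≤∣X∣ = ≤-trans ∣S∣≤∣X─X0∣ (∣p─q∣≤∣p∣ X X0)

  representative⁺ : ∀ {x C a} → x ∈ X ─ X0 → InL G X x C → a ∈ C → Adjacent G x a → a ∉ S →
                    ∃[ a′ ] (a′ ∈ V' ─ S × a′ ∈ C × Adjacent G x a′)
  representative⁺ x∈ C∈L a∈C xa a∉S with proj₁ (proj₁ reduced _ _ x∈ C∈L)
  ... | Q⊆P , ∣Q∣≡ with truncated-subset-escapes Q⊆P ∣Q∣≡ ∣S∣≤∣X∣ (x∈p∩q⁺ (a∈C , ∈N⁺ G xa)) a∉S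
  ... | q , q∈Q , q∉S with x∈p∩q⁻ _ _ (Q⊆P q∈Q)
  ... | q∈C , q∈N = q , x∈p∧x∉q⇒x∈p─q (∈Q⇒∈V' x∈ C∈L (inj₁ q∈Q)) q∉S , q∈C , ∈N⁻ G q∈N

  representative⁻ : ∀ {x C a} → x ∈ X ─ X0 → InL G X x C → a ∈ C → ¬ Adjacent G x a → a ∉ S →
                    ∃[ a′ ] (a′ ∈ V' ─ S × a′ ∈ C × ¬ Adjacent G x a′)
  representative⁻ {x} {C} x∈ C∈L a∈C ¬xa a∉S with proj₂ (proj₁ reduced _ _ x∈ C∈L)
  ... | Q⊆P , ∣Q∣≡ with truncated-subset-escapes Q⊆P ∣Q∣≡ ∣S∣≤∣X∣
                          (x∈p∧x∉q⇒x∈p─q a∈C (λ a∈N → ¬xa (∈N⁻ G a∈N))) a∉S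
  ... | q , q∈Q , q∉S =
    q , x∈p∧x∉q⇒x∈p─q (∈Q⇒∈V' x∈ C∈L (inj₂ q∈Q)) q∉S , p─q⊆p C (N G x) (Q⊆P q∈Q) ,
    λ xq → x∈p─q⇒x∉q C (N G x) (Q⊆P q∈Q) (∈N⁺ G xq)

  -- A neighbour a′ and a non-neighbour b′ of x in one cluster would give the path x – a′ – b′ in V' ∖ S.
  Y∩X-homogeneous : ∀ {x c a b} → x ∈ Y → x ∈ X → c ∉ X → a ∈ cluster c → b ∈ cluster c →
                    a ∉ S → b ∉ S → Adjacent G x a → Adjacent G x b
  Y∩X-homogeneous {x} {b = b} x∈Y x∈X c∉X a∈C b∈C a∉S b∉S xa with adjacent? G x b
  ... | yes xb = xb
  ... | no ¬xb
    with representative⁺ x∈ C∈L a∈C xa a∉S | representative⁻ x∈ C∈L b∈C ¬xb b∉S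
    where x∈ = ∈Y∩X⇒∈X─X0 x∈Y x∈X
          C∈L = cluster-∈L c∉X a∈C xa
  ... | a′ , a′∈ , a′∈C , xa′ | b′ , b′∈ , b′∈C , ¬xb′ with cluster-clique c∉X a′∈C b′∈C
  ... | inj₁ refl = contradiction xa′ ¬xb′
  ... | inj₂ a′b′ = contradiction
        (V'─S-P₃-free (∈Y∩X⇒∈V'─S x∈Y x∈X) a′∈ b′∈ xa′ a′b′ (∈X∧∉X⇒≢ x∈X (∈cluster⇒∉ b′∈C))) ¬xb′

  closes-∈∈∉ : ∀ {u v w} → u ∈ Y → u ∈ X → v ∈ Y → v ∈ X → w ∈ Y → w ∉ X →
               Adjacent G u v → Adjacent G v w → Adjacent G u w
  closes-∈∈∉ u∈Y u∈X v∈Y v∈X w∈Y w∉X uv vw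
    with representative⁺ (∈Y∩X⇒∈X─X0 v∈Y v∈X) (cluster-∈L w∉X (∈cluster-self w∉X) vw)
                         (∈cluster-self w∉X) vw (∈Y⇒∉S w∈Y)
  ... | w′ , w′∈ , w′∈C , vw′ =
    Y∩X-homogeneous u∈Y u∈X w∉X w′∈C (∈cluster-self w∉X) (x∈p─q⇒x∉q V' S w′∈) (∈Y⇒∉S w∈Y)
      (V'─S-P₃-free (∈Y∩X⇒∈V'─S u∈Y u∈X) (∈Y∩X⇒∈V'─S v∈Y v∈X) w′∈ uv vw′
        (∈X∧∉X⇒≢ u∈X (∈cluster⇒∉ w′∈C)))

  closes-∈∉∈ : ∀ {u v w} → u ∈ Y → u ∈ X → v ∈ Y → v ∉ X → w ∈ Y → w ∈ X →
               Adjacent G u v → Adjacent G v w → u ≢ w → Adjacent G u w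
  closes-∈∉∈ u∈Y u∈X v∈Y v∉X w∈Y w∈X uv vw u≢w
    with representative⁺ (∈Y∩X⇒∈X─X0 u∈Y u∈X) (cluster-∈L v∉X (∈cluster-self v∉X) uv)
                         (∈cluster-self v∉X) uv (∈Y⇒∉S v∈Y)
  ... | v′ , v′∈ , v′∈C , uv′ =
    V'─S-P₃-free (∈Y∩X⇒∈V'─S u∈Y u∈X) v′∈ (∈Y∩X⇒∈V'─S w∈Y w∈X) uv′
      (Adjacent-sym G (Y∩X-homogeneous w∈Y w∈X v∉X (∈cluster-self v∉X) v′∈C
        (∈Y⇒∉S v∈Y) (x∈p─q⇒x∉q V' S v′∈) (Adjacent-sym G vw)))
      u≢w

  closes-∈∉∉ : ∀ {u v w} → u ∈ Y → u ∈ X → v ∈ Y → v ∉ X → w ∈ Y → w ∉ X →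
               Adjacent G u v → Adjacent G v w → Adjacent G u w
  closes-∈∉∉ u∈Y u∈X v∈Y v∉X w∈Y w∉X uv vw =
    Y∩X-homogeneous u∈Y u∈X v∉X (∈cluster-self v∉X) (∈cluster⁺ w∉X (inj₂ vw))
      (∈Y⇒∉S v∈Y) (∈Y⇒∉S w∈Y) uv

  closes-∉∈∉ : ∀ {u v w} → u ∈ Y → u ∉ X → v ∈ Y → v ∈ X → w ∈ Y → w ∉ X →
               Adjacent G u v → Adjacent G v w → u ≢ w → Adjacent G u w
  closes-∉∈∉ {u} {v} {w} u∈Y u∉X v∈Y v∈X w∈Y w∉X uv vw u≢w
    with representative⁺ v∈ (cluster-∈L u∉X (∈cluster-self u∉X) vu) (∈cluster-self u∉X) vu (∈Y⇒∉S u∈Y)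
       | representative⁺ v∈ (cluster-∈L w∉X (∈cluster-self w∉X) vw) (∈cluster-self w∉X) vw (∈Y⇒∉S w∈Y)
    where v∈ = ∈Y∩X⇒∈X─X0 v∈Y v∈X
          vu = Adjacent-sym G uv
  ... | u′ , u′∈ , u′∈C , vu′ | w′ , w′∈ , w′∈C , vw′ with clusters-linked u∉X w∉X u′∈C w′∈C u′∼w′
    where
    u′∼w′ : AdjacentOrEqual G u′ w′
    u′∼w′ with u′ ≟ᶠ w′
    ... | yes u′≡w′ = inj₁ u′≡w′
    ... | no  u′≢w′ = inj₂ (V'─S-P₃-free u′∈ (∈Y∩X⇒∈V'─S v∈Y v∈X) w′∈ (Adjacent-sym G vu′) vw′ u′≢w′)
  ... | inj₁ u≡w = contradiction u≡w u≢w
  ... | inj₂ uw  = uw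

  Y-P₃-free : P₃-free G Y
  Y-P₃-free {u} {v} {w} u∈Y v∈Y w∈Y uv vw u≢w with u ∈? X | v ∈? X | w ∈? X
  ... | yes u∈X | yes v∈X | yes w∈X = V'─S-P₃-free
        (∈Y∩X⇒∈V'─S u∈Y u∈X) (∈Y∩X⇒∈V'─S v∈Y v∈X) (∈Y∩X⇒∈V'─S w∈Y w∈X) uv vw u≢w
  ... | yes u∈X | yes v∈X | no  w∉X = closes-∈∈∉ u∈Y u∈X v∈Y v∈X w∈Y w∉X uv vw
  ... | yes u∈X | no  v∉X | yes w∈X = closes-∈∉∈ u∈Y u∈X v∈Y v∉X w∈Y w∈X uv vw u≢w
  ... | yes u∈X | no  v∉X | no  w∉X = closes-∈∉∉ u∈Y u∈X v∈Y v∉X w∈Y w∉X uv vw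
  ... | no  u∉X | yes v∈X | yes w∈X = Adjacent-sym G
        (closes-∈∈∉ w∈Y w∈X v∈Y v∈X u∈Y u∉X (Adjacent-sym G vw) (Adjacent-sym G uv))
  ... | no  u∉X | yes v∈X | no  w∉X = closes-∉∈∉ u∈Y u∉X v∈Y v∈X w∈Y w∉X uv vw u≢w
  ... | no  u∉X | no  v∉X | yes w∈X = Adjacent-sym G
        (closes-∈∉∉ w∈Y w∈X v∈Y v∉X u∈Y u∉X (Adjacent-sym G vw) (Adjacent-sym G uv))
  ... | no  u∉X | no  v∉X | no  w∉X = clusterGraph⇒P₃-free G cvd
        (x∉p⇒x∈∁p u∉X) (x∉p⇒x∈∁p v∉X) (x∉p⇒x∈∁p w∉X) uv vw u≢w

lemma5 : ∀ {n : ℕ} (G : Graph n) (X X0 V' S : Subset n)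
           (Q⁺ Q⁻ : Fin n → Subset n → Subset n) →
           IsCVD G X →
           IsX0 G X X0 →
           IsReducedSet G X X0 V' Q⁺ Q⁻ →
           S ⊆ V' →
           IsClusterGraphOn G (V' ─ S) →
           ∣ S ∣ ≤ ∣ X ─ X0 ∣ →
           IsCVD G (S ∪ X0)
lemma5 G X X0 V' S Q⁺ Q⁻ cvd _ reduced _ V'─S-cluster ∣S∣≤∣X─X0∣ =
  P₃-free⇒clusterGraph G
    (Reduction.Y-P₃-free G X X0 V' S Q⁺ Q⁻ cvd reduced V'─S-cluster ∣S∣≤∣X─X0∣)
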